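{- Let $p \ge 3$ be prime. Then for all $i \in \mathbb{Z}_p \setminus \{0\}$ and all $j \in \mathbb{Z}_p$, $\mathrm{Cay}(D_{2p}; \{r_{i}, r_{ -i}, s_j, s_{i+j}\}) \cong \mathrm{Cay}(\mathbb{Z}_{2p}; \pm\{1, 2\})$.
   Context: $D_{2p}$ is the dihedral group of order $2p$ with elements $r_0,\dots,r_{p-1},s_0,\dots,s_{p-1}$ and multiplication $r_a r_b = r_{a+b}$, $r_a s_b = s_{a+b}$, $s_a r_b = s_{a-b}$, $s_a s_b = r_{a-b}$, subscripts taken modulo $p$. For a group $G$ and a subset $S$ not containing the identity and closed under inverses, $\mathrm{Cay}(G;S)$ has vertex set $G$ with $g$ adjacent to $g\cdot x$ for each $x\in S$. $\pm\{1,2\}=\{1,-1,2,-2\}$. -}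

module Defs where

open import Data.Nat as ℕ using (ℕ; NonZero; _%_; _∸_)
open import Data.Nat.DivMod using (m%n<n)
open import Data.Fin using (Fin; toℕ; fromℕ<)
open import Data.Product using (Σ; ∃; _×_; _,_)
open import Data.List using (List; _∷_; [])
open import Data.List.Membership.Propositional using (_∈_)
open import Relation.Binary.PropositionalEquality using (_≡_)
open import Function.Bundles using (_⤖_; _⇔_; Bijection)

ℤ_ : ℕ → Set
ℤ_ n = Fin n

module _ {n : ℕ} .{{_ : NonZero n}} where
  infixl 6 _⊕_ _⊖_
  _⊕_ : Fin n → Fin n → Fin n
  a ⊕ b = fromℕ< (m%n<n (toℕ a ℕ.+ toℕ b) n)

  ⊝_ : Fin n → Fin n
  ⊝ a = fromℕ< (m%n<n (n ∸ toℕ a) n)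

  _⊖_ : Fin n → Fin n → Fin n
  a ⊖ b = a ⊕ (⊝ b)

  [_] : ℕ → Fin n
  [ k ] = fromℕ< (m%n<n k n)

  zeroₘ : Fin n
  zeroₘ = [ 0 ]

data Dih (n : ℕ) : Set where
  r : Fin n → Dih n
  s : Fin n → Dih n

module _ {n : ℕ} .{{_ : NonZero n}} where
  _·D_ : Dih n → Dih n → Dih n
  r a ·D r b = r (a ⊕ b)
  r a ·D s b = s (a ⊕ b)
  s a ·D r b = s (a ⊖ b)
  s a ·D s b = r (a ⊖ b)

record Graph : Set₁ where
  field
    V   : Set
    Adj : V → V → Set

open Graph public

Cay : (G : Set) → (G → G → G) → List G → Graph
Cay G _·_ S = record { V = G ; Adj = λ g h → Σ G (λ x → x ∈ S × h ≡ g · x) }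

_≅_ : Graph → Graph → Set
Γ ≅ Δ = Σ (V Γ ⤖ V Δ)
          (λ f → ∀ u v → Adj Γ u v ⇔ Adj Δ (Bijection.to f u) (Bijection.to f v))

CayD : (p : ℕ) .{{_ : NonZero p}} → Fin p → Fin p → Graph
CayD p i j = Cay (Dih p) _·D_ (r i ∷ r (⊝ i) ∷ s j ∷ s (i ⊕ j) ∷ [])

CayZ : (m : ℕ) .{{_ : NonZero m}} → Graph
CayZ m = Cay (Fin m) _⊕_ ([ 1 ] ∷ ⊝ [ 1 ] ∷ [ 2 ] ∷ ⊝ [ 2 ] ∷ [])

-- Write p = m + 1, so that m stands for −1 modulo p, and let t be an inverse of i modulo p.
-- The map ℤ_{2p} → D_{2p} sending 2k to r_{ki} and 2k + 1 to s_{(k+1)i+j} walks along the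
-- Cayley graph of D_{2p}: at every vertex the steps ±1 are right multiplications by s_j and
-- s_{i+j}, and the steps ±2 by r_i and r_{−i}, paired up according to the parity of the vertex.
-- So it maps the neighbourhood of each vertex of Cay(ℤ_{2p}; ±{1,2}) onto the neighbourhood of
-- its image, and it is a bijection since k ↦ ki is one modulo p.

module Submission where

open import Defs
open import Data.Nat using (ℕ; zero; suc; _+_; _*_; _∸_; _≤_; NonZero; _%_; _/_; ⌊_/2⌋; parity; ≢-nonZero)
open import Data.Nat.Properties using (m*n≢0; +-comm; +-identityʳ; m∸n+n≡m)
open import Data.Nat.DivMod using (m<n⇒m%n≡m; m≡m%n+[m/n]*n; [m+kn]%n≡m%n; %-distribˡ-+; m%n≤n)
open import Data.Nat.Primality using (Prime)
open import Data.Nat.Coprimality using (Coprime; coprime-Bézout; prime⇒coprime)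
open import Data.Nat.GCD using (module Bézout)
open import Data.Nat.Tactic.RingSolver using (solve)
open import Data.Parity.Base using (Parity; 0ℙ; 1ℙ)
open import Data.Fin using (Fin; toℕ)
open import Data.Fin.Properties using (toℕ-fromℕ<; fromℕ<-toℕ; fromℕ<-cong; toℕ<n; toℕ-injective)
open import Data.List using (List; _∷_; []; _++_; map)
open import Data.List.Properties using (map-∘; map-cong)
open import Data.List.Membership.Propositional.Properties using (∈-map⁺; ∈-map⁻)
open import Data.List.Relation.Binary.Pointwise as Pointwise using (Pointwise-≡⇒≡)
open import Data.List.Relation.Binary.Permutation.Propositional
  using (_↭_; ↭-sym; ↭-refl; ↭-trans; ↭-swap; ↭-prep; ↭-reflexive; module PermutationReasoning)
open import Data.List.Relation.Binary.Permutation.Propositional.Properties using (∈-resp-↭; map⁺; ++-comm)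
open import Data.Product using (∃; _,_)
open import Function.Base using (_∘_)
open import Function.Bundles using (Inverse; _↔_; mk↔ₛ′; mk⇔)
open import Function.Properties.Inverse using (↔⇒⤖)
open import Relation.Binary.PropositionalEquality hiding ([_])
open import Relation.Nullary using (¬_)

module _ {n : ℕ} .{{_ : NonZero n}} where

  toℕ-[] : ∀ x → toℕ ([_] {n} x) ≡ x % n
  toℕ-[] x = toℕ-fromℕ< _

  []-cong : ∀ {x y} → x % n ≡ y % n → [_] {n} x ≡ [ y ]
  []-cong e = fromℕ<-cong _ _ e _ _

  []-toℕ : ∀ a → [_] {n} (toℕ a) ≡ a
  []-toℕ a = trans (fromℕ<-cong _ _ (m<n⇒m%n≡m (toℕ<n a)) _ (toℕ<n a)) (fromℕ<-toℕ a (toℕ<n a))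

  toℕ-[]-split : ∀ x → x ≡ toℕ ([_] {n} x) + x / n * n
  toℕ-[]-split x = trans (m≡m%n+[m/n]*n x n) (cong (_+ x / n * n) (sym (toℕ-[] x)))

  []-mod : ∀ {x y} a b → x + a * n ≡ y + b * n → [_] {n} x ≡ [ y ]
  []-mod {x} {y} a b e = []-cong (begin
    x % n           ≡⟨ [m+kn]%n≡m%n x a n ⟨
    (x + a * n) % n ≡⟨ cong (_% n) e ⟩
    (y + b * n) % n ≡⟨ [m+kn]%n≡m%n y b n ⟩
    y % n           ∎)
    where open ≡-Reasoning

  []-mod⁻¹ : ∀ {x y} → [_] {n} x ≡ [ y ] → x + y / n * n ≡ y + x / n * n
  []-mod⁻¹ {x} {y} e = begin
    x + y / n * n                         ≡⟨ cong (_+ y / n * n) (toℕ-[]-split x) ⟩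
    toℕ ([_] {n} x) + x / n * n + y / n * n ≡⟨ cong (λ v → toℕ v + x / n * n + y / n * n) e ⟩
    toℕ ([_] {n} y) + x / n * n + y / n * n ≡⟨ exchange (toℕ ([_] {n} y)) (x / n * n) (y / n * n) ⟩
    toℕ ([_] {n} y) + y / n * n + x / n * n ≡⟨ cong (_+ x / n * n) (toℕ-[]-split y) ⟨
    y + x / n * n                         ∎
    where
    open ≡-Reasoning
    exchange : ∀ u v w → u + v + w ≡ u + w + v
    exchange u v w = solve (u ∷ v ∷ w ∷ [])

  []-⊕ : ∀ x y → [_] {n} x ⊕ [ y ] ≡ [ x + y ]
  []-⊕ x y = []-cong (begin
    (toℕ ([_] {n} x) + toℕ ([_] {n} y)) % n ≡⟨ cong₂ (λ u v → (u + v) % n) (toℕ-[] x) (toℕ-[] y) ⟩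
    (x % n + y % n) % n                     ≡⟨ %-distribˡ-+ x y n ⟨
    (x + y) % n                             ∎)
    where open ≡-Reasoning

  toℕ-⊕ : ∀ u c → u ⊕ [ c ] ≡ [_] {n} (toℕ u + c)
  toℕ-⊕ u c = trans (cong (_⊕ [ c ]) (sym ([]-toℕ u))) ([]-⊕ (toℕ u) c)

  ⊝-[] : ∀ {x y} a → x + y ≡ a * n → ⊝ [ y ] ≡ [_] {n} x
  ⊝-[] {x} {y} a e = []-mod a (suc (y / n)) (begin
    n ∸ ρ + a * n                 ≡⟨ cong (n ∸ ρ +_) (sym e) ⟩
    n ∸ ρ + (x + y)               ≡⟨ cong (λ v → n ∸ ρ + (x + v)) (toℕ-[]-split y) ⟩
    n ∸ ρ + (x + (ρ + y / n * n)) ≡⟨ regroup (n ∸ ρ) ρ x (y / n * n) ⟩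
    x + (n ∸ ρ + ρ) + y / n * n   ≡⟨ cong (λ v → x + v + y / n * n) (m∸n+n≡m ρ≤n) ⟩
    x + n + y / n * n             ≡⟨ regroup′ x (y / n) ⟩
    x + suc (y / n) * n           ∎)
    where
    open ≡-Reasoning
    ρ = toℕ ([_] {n} y)
    ρ≤n : ρ ≤ n
    ρ≤n = subst (_≤ n) (sym (toℕ-[] y)) (m%n≤n y n)
    regroup : ∀ d c w z → d + (w + (c + z)) ≡ w + (d + c) + z
    regroup d c w z = solve (d ∷ c ∷ w ∷ z ∷ [])
    regroup′ : ∀ w q → w + n + q * n ≡ w + suc q * n
    regroup′ w q = solve (w ∷ q ∷ n ∷ [])

Cay-≅ : ∀ {A B : Set} {_·_ : A → A → A} {_∙_ : B → B → B} {S : List A} {T : List B}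
        (e : A ↔ B) → (∀ u → map (Inverse.from e u ·_) S ↭ map (λ x → Inverse.from e (u ∙ x)) T) →
        Cay A _·_ S ≅ Cay B _∙_ T
Cay-≅ {_·_ = _·_} {_∙_} {S} {T} e local = ↔⇒⤖ e , λ a b → mk⇔ (forward a b) (backward a b)
  where
  open Inverse e
  open ≡-Reasoning

  forward : ∀ a b → Adj (Cay _ _·_ S) a b → Adj (Cay _ _∙_ T) (to a) (to b)
  forward a _ (y , y∈S , refl) with ∈-map⁻ _ (∈-resp-↭ (local (to a)) (∈-map⁺ _ y∈S))
  ... | x , x∈T , eq = x , x∈T , (begin
    to (a · y)               ≡⟨ cong (λ a′ → to (a′ · y)) (strictlyInverseʳ a) ⟨
    to (from (to a) · y)     ≡⟨ cong to eq ⟩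
    to (from (to a ∙ x))     ≡⟨ strictlyInverseˡ _ ⟩
    to a ∙ x                 ∎)

  backward : ∀ a b → Adj (Cay _ _∙_ T) (to a) (to b) → Adj (Cay _ _·_ S) a b
  backward a b (x , x∈T , eq) with ∈-map⁻ _ (∈-resp-↭ (↭-sym (local (to a))) (∈-map⁺ _ x∈T))
  ... | y , y∈S , eq′ = y , y∈S , (begin
    b                        ≡⟨ strictlyInverseʳ b ⟨
    from (to b)              ≡⟨ cong from eq ⟩
    from (to a ∙ x)          ≡⟨ eq′ ⟩
    from (to a) · y          ≡⟨ cong (_· y) (strictlyInverseʳ a) ⟩
    a · y                    ∎)

bit : Parity → ℕ
bit 0ℙ = 0
bit 1ℙ = 1

halve : ∀ x → x ≡ ⌊ x /2⌋ * 2 + bit (parity x)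
halve zero = refl
halve (suc zero) = refl
halve (suc (suc x)) = cong (suc ∘ suc) (halve x)

parity-*2+ : ∀ k y → parity (k * 2 + y) ≡ parity y
parity-*2+ zero y = refl
parity-*2+ (suc k) y = parity-*2+ k y

⌊*2+/2⌋ : ∀ k y → ⌊ k * 2 + y /2⌋ ≡ k + ⌊ y /2⌋
⌊*2+/2⌋ zero y = refl
⌊*2+/2⌋ (suc k) y = cong suc (⌊*2+/2⌋ k y)

module Walk (m I J : ℕ) where

  ⊝[y]≡[m*y] : ∀ y → ⊝ [ y ] ≡ [_] {suc m} (m * y)
  ⊝[y]≡[m*y] y = ⊝-[] {x = m * y} {y} y (solve (y ∷ m ∷ []))

  -- Dihedral elements with labels in ℕ, on which all computations modulo p are ring identities
  -- up to multiples of p (the relation _∼_ below).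
  data Label : Set where
    rot ref : ℕ → Label

  ⟦_⟧ : Label → Dih (suc m)
  ⟦ rot x ⟧ = r [ x ]
  ⟦ ref x ⟧ = s [ x ]

  infixl 7 _⋆_
  _⋆_ : Label → Label → Label
  rot x ⋆ rot y = rot (x + y)
  rot x ⋆ ref y = ref (x + y)
  ref x ⋆ rot y = ref (x + m * y)
  ref x ⋆ ref y = rot (x + m * y)

  ⟦⋆⟧ : ∀ g h → ⟦ g ⋆ h ⟧ ≡ ⟦ g ⟧ ·D ⟦ h ⟧
  ⟦⋆⟧ (rot x) (rot y) = cong r (sym ([]-⊕ x y))
  ⟦⋆⟧ (rot x) (ref y) = cong s (sym ([]-⊕ x y))
  ⟦⋆⟧ (ref x) (rot y) = cong s (sym (trans (cong ([ x ] ⊕_) (⊝[y]≡[m*y] y)) ([]-⊕ x (m * y))))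
  ⟦⋆⟧ (ref x) (ref y) = cong r (sym (trans (cong ([ x ] ⊕_) (⊝[y]≡[m*y] y)) ([]-⊕ x (m * y))))

  infix 4 _∼_
  data _∼_ : Label → Label → Set where
    rot-mod : ∀ {x y} a b → x + a * suc m ≡ y + b * suc m → rot x ∼ rot y
    ref-mod : ∀ {x y} a b → x + a * suc m ≡ y + b * suc m → ref x ∼ ref y

  ⟦⟧-cong : ∀ {g h} → g ∼ h → ⟦ g ⟧ ≡ ⟦ h ⟧
  ⟦⟧-cong (rot-mod a b e) = cong r ([]-mod a b e)
  ⟦⟧-cong (ref-mod a b e) = cong s ([]-mod a b e)

  vertex : Parity → ℕ → Label
  vertex 0ℙ k = rot (k * I)
  vertex 1ℙ k = ref (k * I + (I + J))

  vertex-mod : ∀ b k k′ a a′ → k + a * suc m ≡ k′ + a′ * suc m → vertex b k ∼ vertex b k′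
  vertex-mod 0ℙ k k′ a a′ e = rot-mod (a * I) (a′ * I) (begin
    k * I + a * I * suc m   ≡⟨ solve (k ∷ a ∷ I ∷ m ∷ []) ⟩
    (k + a * suc m) * I     ≡⟨ cong (_* I) e ⟩
    (k′ + a′ * suc m) * I   ≡⟨ solve (k′ ∷ a′ ∷ I ∷ m ∷ []) ⟩
    k′ * I + a′ * I * suc m ∎)
    where open ≡-Reasoning
  vertex-mod 1ℙ k k′ a a′ e = ref-mod (a * I) (a′ * I) (begin
    k * I + (I + J) + a * I * suc m   ≡⟨ solve (k ∷ a ∷ I ∷ J ∷ m ∷ []) ⟩
    (k + a * suc m) * I + (I + J)     ≡⟨ cong (λ v → v * I + (I + J)) e ⟩
    (k′ + a′ * suc m) * I + (I + J)   ≡⟨ solve (k′ ∷ a′ ∷ I ∷ J ∷ m ∷ []) ⟩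
    k′ * I + (I + J) + a′ * I * suc m ∎)
    where open ≡-Reasoning

  walk : ℕ → Label
  walk x = vertex (parity x) ⌊ x /2⌋

  walk-*2+ : ∀ k y → walk (k * 2 + y) ≡ vertex (parity y) (k + ⌊ y /2⌋)
  walk-*2+ k y = cong₂ vertex (parity-*2+ k y) (⌊*2+/2⌋ k y)

  walk-*2+bit : ∀ b k → walk (k * 2 + bit b) ≡ vertex b k
  walk-*2+bit 0ℙ k = trans (walk-*2+ k 0) (cong (vertex 0ℙ) (+-identityʳ k))
  walk-*2+bit 1ℙ k = trans (walk-*2+ k 1) (cong (vertex 1ℙ) (+-identityʳ k))

  walk-% : ∀ x → ⟦ walk (x % (2 * suc m)) ⟧ ≡ ⟦ walk x ⟧
  walk-% x = sym (begin
    ⟦ walk x ⟧                                 ≡⟨ cong (⟦_⟧ ∘ walk) (trans (m≡m%n+[m/n]*n x N) (regroup ρ q)) ⟩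
    ⟦ walk (q * suc m * 2 + ρ) ⟧                ≡⟨ cong ⟦_⟧ (walk-*2+ (q * suc m) ρ) ⟩
    ⟦ vertex (parity ρ) (q * suc m + ⌊ ρ /2⌋) ⟧ ≡⟨ ⟦⟧-cong (vertex-mod (parity ρ) _ _ 0 q swap) ⟩
    ⟦ vertex (parity ρ) ⌊ ρ /2⌋ ⟧               ∎)
    where
    open ≡-Reasoning
    N = 2 * suc m
    ρ = x % N
    q = x / N
    swap : q * suc m + ⌊ ρ /2⌋ + 0 ≡ ⌊ ρ /2⌋ + q * suc m
    swap = trans (+-identityʳ _) (+-comm (q * suc m) ⌊ ρ /2⌋)
    regroup : ∀ u v → u + v * (2 * suc m) ≡ v * suc m * 2 + u
    regroup u v = solve (u ∷ v ∷ m ∷ [])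

  rots refs generators : List Label
  rots = rot I ∷ rot (m * I) ∷ []
  refs = ref J ∷ ref (I + J) ∷ []
  generators = rots ++ refs

  even-order : generators ↭ ref (I + J) ∷ ref J ∷ rot I ∷ rot (m * I) ∷ []
  even-order = ↭-trans (++-comm rots refs) (↭-swap (ref J) (ref (I + J)) ↭-refl)

  odd-order : generators ↭ ref J ∷ ref (I + J) ∷ rot (m * I) ∷ rot I ∷ []
  odd-order = ↭-trans (++-comm rots refs)
    (↭-prep (ref J) (↭-prep (ref (I + J)) (↭-swap (rot I) (rot (m * I)) ↭-refl)))

  -- m * 2 + 1 and m * 2 are −1 and −2 modulo 2p.
  steps : List ℕ
  steps = 1 ∷ m * 2 + 1 ∷ 2 ∷ m * 2 + 0 ∷ []

  walk-⋆ : ∀ b k l c g → vertex b k ⋆ g ∼ vertex (parity (bit b + c)) (k + l + ⌊ bit b + c /2⌋) →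
           ⟦ vertex b k ⟧ ·D ⟦ g ⟧ ≡ ⟦ walk (k * 2 + bit b + (l * 2 + c)) ⟧
  walk-⋆ b k l c g e = begin
    ⟦ vertex b k ⟧ ·D ⟦ g ⟧
      ≡⟨ ⟦⋆⟧ (vertex b k) g ⟨
    ⟦ vertex b k ⋆ g ⟧
      ≡⟨ ⟦⟧-cong e ⟩
    ⟦ vertex (parity (bit b + c)) (k + l + ⌊ bit b + c /2⌋) ⟧
      ≡⟨ cong ⟦_⟧ (walk-*2+ (k + l) (bit b + c)) ⟨
    ⟦ walk ((k + l) * 2 + (bit b + c)) ⟧
      ≡⟨ cong (⟦_⟧ ∘ walk) (regroup k (bit b) l c) ⟩
    ⟦ walk (k * 2 + bit b + (l * 2 + c)) ⟧
      ∎
    where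
    open ≡-Reasoning
    regroup : ∀ k β l c → (k + l) * 2 + (β + c) ≡ k * 2 + β + (l * 2 + c)
    regroup k β l c = solve (k ∷ β ∷ l ∷ c ∷ [])

  vertex-neighbours : ∀ {x} b k → x ≡ k * 2 + bit b →
                      map (⟦ vertex b k ⟧ ·D_) (map ⟦_⟧ generators) ↭
                      map (λ c → ⟦ walk (x + c) ⟧) steps
  -- One row per entry l * 2 + c of steps: the generator it multiplies by, and the multiples of p.
  vertex-neighbours 0ℙ k refl =
    ↭-trans (map⁺ (⟦ vertex 0ℙ k ⟧ ·D_) (map⁺ ⟦_⟧ even-order))
            (↭-reflexive (Pointwise-≡⇒≡
              (    walk-⋆ 0ℙ k 0 1 (ref (I + J)) (ref-mod 0 0 (solve (k ∷ m ∷ I ∷ J ∷ [])))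
      Pointwise.∷ walk-⋆ 0ℙ k m 1 (ref J)       (ref-mod I 0 (solve (k ∷ m ∷ I ∷ J ∷ [])))
      Pointwise.∷ walk-⋆ 0ℙ k 0 2 (rot I)       (rot-mod 0 0 (solve (k ∷ m ∷ I ∷ J ∷ [])))
      Pointwise.∷ walk-⋆ 0ℙ k m 0 (rot (m * I)) (rot-mod 0 0 (solve (k ∷ m ∷ I ∷ J ∷ [])))
      Pointwise.∷ Pointwise.[])))
  vertex-neighbours 1ℙ k refl =
    ↭-trans (map⁺ (⟦ vertex 1ℙ k ⟧ ·D_) (map⁺ ⟦_⟧ odd-order))
            (↭-reflexive (Pointwise-≡⇒≡
              (    walk-⋆ 1ℙ k 0 1 (ref J)       (rot-mod 0 J (solve (k ∷ m ∷ I ∷ J ∷ [])))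
      Pointwise.∷ walk-⋆ 1ℙ k m 1 (ref (I + J)) (rot-mod 0 J (solve (k ∷ m ∷ I ∷ J ∷ [])))
      Pointwise.∷ walk-⋆ 1ℙ k 0 2 (rot (m * I)) (ref-mod (2 * I) (I * suc m) (solve (k ∷ m ∷ I ∷ J ∷ [])))
      Pointwise.∷ walk-⋆ 1ℙ k m 0 (rot I)       (ref-mod 0 0 (solve (k ∷ m ∷ I ∷ J ∷ [])))
      Pointwise.∷ Pointwise.[])))

  walk-neighbours : ∀ x → map (⟦ walk x ⟧ ·D_) (map ⟦_⟧ generators) ↭
                          map (λ c → ⟦ walk (x + c) ⟧) steps
  walk-neighbours x = vertex-neighbours (parity x) ⌊ x /2⌋ (halve x)

  walk-⊕ : ∀ u c → ⟦ walk (toℕ (u ⊕ [ c ])) ⟧ ≡ ⟦ walk (toℕ u + c) ⟧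
  walk-⊕ u c = trans (cong (⟦_⟧ ∘ walk ∘ toℕ) (toℕ-⊕ u c))
                     (trans (cong (⟦_⟧ ∘ walk) (toℕ-[] (toℕ u + c))) (walk-% (toℕ u + c)))

  module WalkInverse (t a c : ℕ) (t-inverse : t * I + a * suc m ≡ 1 + c * suc m) where

    cancel : ∀ z → z * t * I + z * a * suc m ≡ z + z * c * suc m
    cancel z = begin
      z * t * I + z * a * suc m ≡⟨ solve (z ∷ t ∷ I ∷ a ∷ m ∷ []) ⟩
      z * (t * I + a * suc m)   ≡⟨ cong (z *_) t-inverse ⟩
      z * (1 + c * suc m)       ≡⟨ solve (z ∷ c ∷ m ∷ []) ⟩
      z + z * c * suc m         ∎
      where open ≡-Reasoning

    label : Parity → ℕ → Label
    label 0ℙ = rot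
    label 1ℙ = ref

    -- Solves vertex b k ∼ label b z for k.
    coordinate : Parity → ℕ → ℕ
    coordinate 0ℙ z = z * t
    coordinate 1ℙ z = (z + m * (I + J)) * t

    vertex-coordinate : ∀ b z → vertex b (coordinate b z) ∼ label b z
    vertex-coordinate 0ℙ z = rot-mod (z * a) (z * c) (cancel z)
    vertex-coordinate 1ℙ z = ref-mod ((z + m * (I + J)) * a) (I + J + (z + m * (I + J)) * c) (begin
      (z + m * (I + J)) * t * I + (I + J) + (z + m * (I + J)) * a * suc m
        ≡⟨ solve (z ∷ t ∷ I ∷ J ∷ a ∷ m ∷ []) ⟩
      (z + m * (I + J)) * t * I + (z + m * (I + J)) * a * suc m + (I + J)
        ≡⟨ cong (_+ (I + J)) (cancel (z + m * (I + J))) ⟩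
      z + m * (I + J) + (z + m * (I + J)) * c * suc m + (I + J)
        ≡⟨ solve (z ∷ c ∷ I ∷ J ∷ m ∷ []) ⟩
      z + (I + J + (z + m * (I + J)) * c) * suc m
        ∎)
      where open ≡-Reasoning

    place : Parity → ℕ → Fin (2 * suc m)
    place b k = [ k * 2 + bit b ]

    place-mod : ∀ b k k′ a a′ → k + a * suc m ≡ k′ + a′ * suc m → place b k ≡ place b k′
    place-mod b k k′ a a′ e = []-mod a a′ (begin
      k * 2 + bit b + a * (2 * suc m)   ≡⟨ double k (bit b) a ⟩
      (k + a * suc m) * 2 + bit b       ≡⟨ cong (λ v → v * 2 + bit b) e ⟩
      (k′ + a′ * suc m) * 2 + bit b     ≡⟨ double k′ (bit b) a′ ⟨
      k′ * 2 + bit b + a′ * (2 * suc m) ∎)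
      where
      open ≡-Reasoning
      double : ∀ k β a → k * 2 + β + a * (2 * suc m) ≡ (k + a * suc m) * 2 + β
      double k β a = solve (k ∷ β ∷ a ∷ m ∷ [])

    walk-place : ∀ b k → ⟦ walk (toℕ (place b k)) ⟧ ≡ ⟦ vertex b k ⟧
    walk-place b k = trans (cong (⟦_⟧ ∘ walk) (toℕ-[] (k * 2 + bit b)))
                           (trans (walk-% (k * 2 + bit b)) (cong ⟦_⟧ (walk-*2+bit b k)))

    unwalk : Dih (suc m) → Fin (2 * suc m)
    unwalk (r x) = place 0ℙ (coordinate 0ℙ (toℕ x))
    unwalk (s x) = place 1ℙ (coordinate 1ℙ (toℕ x))

    coordinate-rot : ∀ k ρ q → k * I ≡ ρ + q * suc m →
                     coordinate 0ℙ ρ + (q * t + k * a) * suc m ≡ k + k * c * suc m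
    coordinate-rot k ρ q e = begin
      ρ * t + (q * t + k * a) * suc m     ≡⟨ solve (ρ ∷ t ∷ q ∷ k ∷ a ∷ m ∷ []) ⟩
      (ρ + q * suc m) * t + k * a * suc m ≡⟨ cong (λ v → v * t + k * a * suc m) e ⟨
      k * I * t + k * a * suc m           ≡⟨ solve (k ∷ I ∷ t ∷ a ∷ m ∷ []) ⟩
      k * t * I + k * a * suc m           ≡⟨ cancel k ⟩
      k + k * c * suc m                   ∎
      where open ≡-Reasoning

    coordinate-ref : ∀ k ρ q → k * I + (I + J) ≡ ρ + q * suc m →
                     coordinate 1ℙ ρ + (q * t + k * a) * suc m ≡ k + (k * c + (I + J) * t) * suc m
    coordinate-ref k ρ q e = begin
      (ρ + m * (I + J)) * t + (q * t + k * a) * suc m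
        ≡⟨ solve (ρ ∷ t ∷ q ∷ k ∷ a ∷ I ∷ J ∷ m ∷ []) ⟩
      (ρ + q * suc m + m * (I + J)) * t + k * a * suc m
        ≡⟨ cong (λ v → (v + m * (I + J)) * t + k * a * suc m) e ⟨
      (k * I + (I + J) + m * (I + J)) * t + k * a * suc m
        ≡⟨ solve (k ∷ I ∷ J ∷ t ∷ a ∷ m ∷ []) ⟩
      k * t * I + k * a * suc m + (I + J) * t * suc m
        ≡⟨ cong (_+ (I + J) * t * suc m) (cancel k) ⟩
      k + k * c * suc m + (I + J) * t * suc m
        ≡⟨ solve (k ∷ c ∷ I ∷ J ∷ t ∷ m ∷ []) ⟩
      k + (k * c + (I + J) * t) * suc m
        ∎
      where open ≡-Reasoning

    unwalk-vertex : ∀ b k → unwalk ⟦ vertex b k ⟧ ≡ place b k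
    unwalk-vertex 0ℙ k =
      place-mod 0ℙ (coordinate 0ℙ ρ) k (q * t + k * a) (k * c) (coordinate-rot k ρ q (toℕ-[]-split w))
      where
      w = k * I
      ρ = toℕ ([_] {suc m} w)
      q = w / suc m
    unwalk-vertex 1ℙ k =
      place-mod 1ℙ (coordinate 1ℙ ρ) k (q * t + k * a) (k * c + (I + J) * t)
                (coordinate-ref k ρ q (toℕ-[]-split w))
      where
      w = k * I + (I + J)
      ρ = toℕ ([_] {suc m} w)
      q = w / suc m

    walk-unwalk : ∀ d → ⟦ walk (toℕ (unwalk d)) ⟧ ≡ d
    walk-unwalk (r x) = trans (walk-place 0ℙ (coordinate 0ℙ (toℕ x)))
                              (trans (⟦⟧-cong (vertex-coordinate 0ℙ (toℕ x))) (cong r ([]-toℕ x)))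
    walk-unwalk (s x) = trans (walk-place 1ℙ (coordinate 1ℙ (toℕ x)))
                              (trans (⟦⟧-cong (vertex-coordinate 1ℙ (toℕ x))) (cong s ([]-toℕ x)))

    unwalk-walk : ∀ u → unwalk ⟦ walk (toℕ u) ⟧ ≡ u
    unwalk-walk u = begin
      unwalk ⟦ walk (toℕ u) ⟧                   ≡⟨ unwalk-vertex (parity (toℕ u)) ⌊ toℕ u /2⌋ ⟩
      [ ⌊ toℕ u /2⌋ * 2 + bit (parity (toℕ u)) ] ≡⟨ cong [_] (halve (toℕ u)) ⟨
      [ toℕ u ]                                 ≡⟨ []-toℕ u ⟩
      u                                         ∎
      where open ≡-Reasoning

    walk-inverse : Dih (suc m) ↔ Fin (2 * suc m)
    walk-inverse = mk↔ₛ′ unwalk (λ u → ⟦ walk (toℕ u) ⟧) unwalk-walk walk-unwalk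

    Cay-walk : Cay (Dih (suc m)) _·D_ (map ⟦_⟧ generators) ≅ Cay (Fin (2 * suc m)) _⊕_ (map [_] steps)
    Cay-walk = Cay-≅ {_·_ = _·D_} {_⊕_} {map ⟦_⟧ generators} {map [_] steps} walk-inverse λ u → begin
      map (⟦ walk (toℕ u) ⟧ ·D_) (map ⟦_⟧ generators)    ↭⟨ walk-neighbours (toℕ u) ⟩
      map (λ c → ⟦ walk (toℕ u + c) ⟧) steps            ≡⟨ map-cong (walk-⊕ u) steps ⟨
      map (λ c → ⟦ walk (toℕ (u ⊕ [ c ])) ⟧) steps      ≡⟨ map-∘ {g = λ x → ⟦ walk (toℕ (u ⊕ x)) ⟧} {[_]} steps ⟩
      map (λ x → ⟦ walk (toℕ (u ⊕ x)) ⟧) (map [_] steps) ∎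
      where open PermutationReasoning

coprime⇒invertible : ∀ {m x} → Coprime (suc m) x → ∃ λ t → [_] {suc m} (t * x) ≡ [ 1 ]
coprime⇒invertible {m} {x} coprime with coprime-Bézout coprime
... | Bézout.+- u v eq = m * v , []-mod u (v * x) (begin
  m * v * x + u * suc m   ≡⟨ cong (m * v * x +_) eq ⟨
  m * v * x + (1 + v * x) ≡⟨ solve (m ∷ v ∷ x ∷ []) ⟩
  1 + v * x * suc m       ∎)
  where open ≡-Reasoning
... | Bézout.-+ u v eq = v , []-mod 0 u (trans (+-identityʳ (v * x)) (sym eq))

CayD≅CayZ : ∀ m (i j : Fin (suc m)) → ∃ (λ t → [_] {suc m} (t * toℕ i) ≡ [ 1 ]) →
            CayD (suc m) i j ≅ CayZ (2 * suc m)
CayD≅CayZ m i j (t , t*i≡1) =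
  subst₂ (λ S T → Cay (Dih (suc m)) _·D_ S ≅ Cay (Fin (2 * suc m)) _⊕_ T)
         D-generators Z-generators Cay-walk
  where
  open Walk m (toℕ i) (toℕ j)
  open WalkInverse t (1 / suc m) (t * toℕ i / suc m) ([]-mod⁻¹ {x = t * toℕ i} {1} t*i≡1)

  D-generators : map ⟦_⟧ generators ≡ r i ∷ r (⊝ i) ∷ s j ∷ s (i ⊕ j) ∷ []
  D-generators = cong₂ _∷_ (cong r ([]-toℕ i))
                   (cong₂ _∷_ (cong r (trans (sym (⊝[y]≡[m*y] (toℕ i))) (cong ⊝_ ([]-toℕ i))))
                     (cong₂ _∷_ (cong s ([]-toℕ j)) refl))

  Z-generators : map [_] steps ≡ [ 1 ] ∷ ⊝ [ 1 ] ∷ [ 2 ] ∷ ⊝ [ 2 ] ∷ []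
  Z-generators = cong ([ 1 ] ∷_) (cong₂ _∷_ (sym (⊝-[] {2 * suc m} {x = m * 2 + 1} {1} 1 (solve (m ∷ []))))
                   (cong ([ 2 ] ∷_) (cong (_∷ []) (sym (⊝-[] {2 * suc m} {x = m * 2 + 0} {2} 1 (solve (m ∷ [])))))))

-- Primality is used only to invert i modulo p.
lemma7 : (p : ℕ) → .{{_ : NonZero p}} → Prime p → 3 ≤ p →
         (i j : Fin p) → ¬ (i ≡ zeroₘ) →
         CayD p i j ≅ CayZ (2 * p) {{m*n≢0 2 p}}
lemma7 (suc m) p-prime _ i j i≢0 =
  CayD≅CayZ m i j (coprime⇒invertible (prime⇒coprime p-prime {{≢-nonZero toℕi≢0}} (toℕ<n i)))
  where
  toℕi≢0 : toℕ i ≢ 0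
  toℕi≢0 e = i≢0 (toℕ-injective (trans e (sym (toℕ-[] 0))))
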